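{- Let $n\ge1$, $N=\{0,\dots,n-1\}$, and for $i\in N$ let $X_i\in\mathbb{Z}_2^n$ be the sequence with $-1$ in position $i$ and $+1$ elsewhere. For each subset $T\subseteq N$ (including $T=\emptyset$) and each partition $P(T)=\{T_1,\dots,T_s\}$ of $T$ into nonempty blocks, let $H(T,P(T))$ be the subgroup of $\mathbb{Z}_2^n$ generated by $Y_{T_1},\dots,Y_{T_s}$, where $Y_{T_j}=\prod_{i\in T_j}X_i$ (for $T=\emptyset$ this is the trivial subgroup). Such subgroups are called $P(T)$-free subgroups. Then the number of $P(T)$-free subgroups of $\mathbb{Z}_2^n$ is the Bell number $B_{n+1}$.
   Context: $\mathbb{Z}_2^n$ is the group of $\pm1$ sequences of length $n$ under coordinatewise multiplication. $B_m$ denotes the $m$-th Bell number (the number of partitions of an $m$-element set, with $B_0=1$). -}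

module Defs where

open import Data.Nat using (ℕ; zero; suc; _+_; _*_)
open import Data.Bool using (Bool; true; false; _xor_; if_then_else_)
open import Data.Fin using (Fin; _≟_)
open import Data.Fin.Subset using (Subset; _∈_; _∩_; ⋃; Nonempty; Empty)
open import Data.Fin.Subset.Properties using (_∈?_)
open import Data.Vec using (Vec; zipWith; replicate; tabulate)
open import Data.List using (List; []; _∷_; map; foldr; upTo; allFin)
open import Data.Nat.ListAction using (sum)
open import Data.List.Relation.Unary.All using (All)
open import Data.List.Relation.Unary.AllPairs using (AllPairs)
open import Data.List.Membership.Propositional renaming (_∈_ to _∈ˡ_)
open import Data.Product using (Σ; _×_)
open import Relation.Binary.PropositionalEquality using (_≡_)
open import Relation.Nullary using (does)

S₂ : ℕ → ℕ → ℕ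
S₂ zero    zero    = 1
S₂ zero    (suc k) = 0
S₂ (suc m) zero    = 0
S₂ (suc m) (suc k) = suc k * S₂ m (suc k) + S₂ m k

Bell : ℕ → ℕ
Bell m = sum (map (S₂ m) (upTo (suc m)))

-- ℤ₂ⁿ : a ±1 sequence is encoded as a Bool vector, true ↦ -1, false ↦ +1.
Z2 : ℕ → Set
Z2 n = Vec Bool n

-- coordinatewise multiplication of ±1 corresponds to xor
_·_ : ∀ {n} → Z2 n → Z2 n → Z2 n
_·_ = zipWith _xor_

one : ∀ {n} → Z2 n
one = replicate _ false

-- inverse in ℤ₂ⁿ (every element is its own inverse)
inv : ∀ {n} → Z2 n → Z2 n
inv x = x

X : ∀ {n} → Fin n → Z2 n
X i = tabulate (λ j → does (i ≟ j))

Y : ∀ {n} → Subset n → Z2 n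
Y {n} B = foldr (λ i acc → (if does (i ∈? B) then X i else one) · acc) one (allFin n)

data ⟨_⟩∋_ {n} (gs : List (Z2 n)) : Z2 n → Set where
  gen  : ∀ {g} → g ∈ˡ gs → ⟨ gs ⟩∋ g
  unit : ⟨ gs ⟩∋ one
  mul  : ∀ {g h} → ⟨ gs ⟩∋ g → ⟨ gs ⟩∋ h → ⟨ gs ⟩∋ (g · h)
  invc : ∀ {g} → ⟨ gs ⟩∋ g → ⟨ gs ⟩∋ inv g

record Partition {n} (T : Subset n) : Set where
  field
    blocks   : List (Subset n)
    nonempty : All Nonempty blocks
    disjoint : AllPairs (λ A B → Empty (A ∩ B)) blocks
    cover    : ⋃ blocks ≡ T

PT : ℕ → Set
PT n = Σ (Subset n) Partition

H∋ : ∀ {n} → PT n → Z2 n → Set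
H∋ (T Data.Product., P) g = ⟨ map Y (Partition.blocks P) ⟩∋ g

SameSubgroup : ∀ {n} → PT n → PT n → Set
SameSubgroup a b = ∀ g → (H∋ a g → H∋ b g) × (H∋ b g → H∋ a g)

module Submission where

-- A P(T)-free subgroup is determined by, and determines, a partition of N ∪ {⋆}: the blocks
-- T₁, …, Tₛ together with the block (N ∖ T) ∪ {⋆}. Since Y_B is the indicator vector of B,
-- every element of H(T, P(T)), read as a function on N ∪ {⋆} vanishing at ⋆, is constant on
-- the blocks of that partition, while each Y_{Tⱼ} lies in the subgroup; so two such subgroups
-- coincide exactly when their partitions of N ∪ {⋆} do, i.e. when the maps sending a point to
-- its block have the same kernel. Partitions of the (n+1)-set N ∪ {⋆} are counted by restricted
-- growth strings, and those with k blocks are in bijection with Fin (S₂ (n+1) k).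

open import Defs
open import Data.Nat using (ℕ; zero; suc; _≤_; _<_; _≥_; z≤n; s≤s; s≤s⁻¹)
open import Data.Nat.Properties using (m≤n⇒m≤1+n; n≮0)
open import Data.Nat.ListAction using (sum)
import Data.Bool as Bool
open import Data.Bool using (Bool; true; false; _xor_; if_then_else_)
open import Data.Bool.Properties using (xor-identityˡ; xor-identityʳ)
open import Data.Fin as Fin using (Fin; zero; suc; _≟_)
open import Data.Fin.Properties using (suc-injective; any?; +↔⊎; *↔×)
open import Data.Fin.Subset using (Subset; _∈_; _∩_; ⋃; Nonempty; Empty)
open import Data.Fin.Subset.Properties using (_∈?_; nonempty?; ⊆-antisym; x∈p∩q⁺; p∩q⊆p; p∩q⊆q)
open import Data.Vec using ([]; _∷_; tabulate; lookup)
import Data.Vec.Properties as Vec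
open import Data.Vec.Properties
  using (lookup∘tabulate; []=⇒lookup; lookup⇒[]=; lookup-zipWith; lookup-replicate; zipWith-identityˡ)
open import Data.List using (List; []; _∷_; map; foldr; allFin; filter; applyUpTo)
import Data.List.Properties as List
import Data.List.Relation.Unary.All as All
import Data.List.Relation.Unary.All.Properties as All
open import Data.List.Relation.Unary.AllPairs using (AllPairs; _∷_)
import Data.List.Relation.Unary.AllPairs as AllPairs
import Data.List.Relation.Unary.AllPairs.Properties as AllPairs
open import Data.List.Relation.Unary.Any using (here; there)
open import Data.List.Relation.Unary.Unique.Propositional.Properties using (allFin⁺)
open import Data.List.Relation.Binary.Subset.Propositional using () renaming (_⊆_ to _⊆ˡ_)
import Data.List.Relation.Binary.Subset.Propositional.Properties as ⊆ˡ
open import Data.List.Membership.Propositional using () renaming (_∈_ to _∈ˡ_)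
open import Data.List.Membership.Propositional.Properties
  using (∈-map⁺; ∈-map⁻; ∈-filter⁺; ∈-allFin; ∈-map∘filter⁻)
open import Data.Maybe using (Maybe; just; nothing)
open import Data.Maybe.Properties as Maybe using (just-injective)
open import Data.Product using (Σ; ∃; _×_; _,_; proj₁; proj₂)
open import Data.Product.Function.NonDependent.Propositional using (_×-↔_)
open import Data.Sum using (_⊎_; inj₁; inj₂)
open import Data.Sum.Function.Propositional using (_⊎-↔_)
open import Data.Empty using (⊥-elim)
open import Function using (_∘_; case_of_)
open import Function.Bundles using (_⇔_; _↔_; mk⇔; mk↔ₛ′; Equivalence; Inverse; Injection)
open import Function.Definitions using (Injective)
open import Function.Properties.Inverse using (↔-refl; ↔-sym; ↔-trans; ↔⇒↣)
import Function.Properties.Equivalence as ⇔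
open import Relation.Binary.Definitions using (DecidableEquality)
open import Relation.Binary.PropositionalEquality using (_≡_; _≢_; refl; sym; trans; cong; cong₂; subst)
open import Relation.Nullary using (Dec; yes; no; does; ¬?; _×-dec_)

open Equivalence using (to; from)

-- A restricted growth string read from the right: `old ℓ` puts the new first point into
-- block ℓ, `new` puts it into a new block, which gets label zero while older labels shift up.
data RGS : ℕ → ℕ → Set where
  []  : RGS 0 0
  old : ∀ {m k} → Fin k → RGS m k → RGS (suc m) k
  new : ∀ {m k} → RGS m k → RGS (suc m) (suc k)

label : ∀ {m k} → RGS m k → Fin m → Fin k
label (old ℓ r) zero    = ℓ
label (old ℓ r) (suc i) = label r i
label (new r)   zero    = zero
label (new r)   (suc i) = suc (label r i)

label-surjective : ∀ {m k} (r : RGS m k) (ℓ : Fin k) → ∃ λ i → label r i ≡ ℓ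
label-surjective (old _ r) ℓ       = let i , e = label-surjective r ℓ in suc i , e
label-surjective (new r)   zero    = zero , refl
label-surjective (new r)   (suc ℓ) = let i , e = label-surjective r ℓ in suc i , cong suc e

RGS-bound : ∀ {m k} → RGS m k → k ≤ m
RGS-bound []        = z≤n
RGS-bound (old _ r) = m≤n⇒m≤1+n (RGS-bound r)
RGS-bound (new r)   = s≤s (RGS-bound r)

RGS-unfold : ∀ {m k} → RGS (suc m) (suc k) ↔ ((Fin (suc k) × RGS m (suc k)) ⊎ RGS m k)
RGS-unfold = mk↔ₛ′ split join
  (λ { (inj₁ _) → refl ; (inj₂ _) → refl })
  (λ { (old _ _) → refl ; (new _) → refl })
  where
  split : ∀ {m k} → RGS (suc m) (suc k) → (Fin (suc k) × RGS m (suc k)) ⊎ RGS m k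
  split (old ℓ r) = inj₁ (ℓ , r)
  split (new r)   = inj₂ r
  join : ∀ {m k} → (Fin (suc k) × RGS m (suc k)) ⊎ RGS m k → RGS (suc m) (suc k)
  join (inj₁ (ℓ , r)) = old ℓ r
  join (inj₂ r)       = new r

RGS↔S₂ : ∀ m k → RGS m k ↔ Fin (S₂ m k)
RGS↔S₂ zero    zero    = mk↔ₛ′ (λ { [] → zero }) (λ { zero → [] }) (λ { zero → refl }) (λ { [] → refl })
RGS↔S₂ zero    (suc k) = mk↔ₛ′ (λ ()) (λ ()) (λ ()) (λ ())
RGS↔S₂ (suc m) zero    = mk↔ₛ′ (λ { (old () _) }) (λ ()) (λ ()) (λ { (old () _) })
RGS↔S₂ (suc m) (suc k) =
  ↔-trans RGS-unfold
    (↔-trans ((↔-refl ×-↔ RGS↔S₂ m (suc k)) ⊎-↔ RGS↔S₂ m k)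
      (↔-sym (↔-trans +↔⊎ (*↔× ⊎-↔ ↔-refl))))

Σℕ-unfold : {A : ℕ → Set} → Σ ℕ A ↔ (A 0 ⊎ Σ ℕ (A ∘ suc))
Σℕ-unfold {A} = mk↔ₛ′ split join
  (λ { (inj₁ _) → refl ; (inj₂ _) → refl })
  (λ { (zero , _) → refl ; (suc _ , _) → refl })
  where
  split : Σ ℕ A → A 0 ⊎ Σ ℕ (A ∘ suc)
  split (zero , a)  = inj₁ a
  split (suc k , a) = inj₂ (k , a)
  join : A 0 ⊎ Σ ℕ (A ∘ suc) → Σ ℕ A
  join (inj₁ a)       = zero , a
  join (inj₂ (k , a)) = suc k , a

Σℕ↔Fin-sum : {A : ℕ → Set} (f : ℕ → ℕ) (b : ℕ) → (∀ k → A k ↔ Fin (f k)) → (∀ {k} → A k → k < b) →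
  Σ ℕ A ↔ Fin (sum (applyUpTo f b))
Σℕ↔Fin-sum f zero    A↔ bound =
  mk↔ₛ′ (λ (_ , a) → ⊥-elim (n≮0 (bound a))) (λ ()) (λ ()) (λ (_ , a) → ⊥-elim (n≮0 (bound a)))
Σℕ↔Fin-sum f (suc b) A↔ bound =
  ↔-trans Σℕ-unfold
    (↔-trans (A↔ 0 ⊎-↔ Σℕ↔Fin-sum (f ∘ suc) b (A↔ ∘ suc) (s≤s⁻¹ ∘ bound))
      (↔-sym +↔⊎))

Σ-RGS↔Bell : ∀ m → Σ ℕ (RGS m) ↔ Fin (Bell m)
Σ-RGS↔Bell m = subst (λ xs → Σ ℕ (RGS m) ↔ Fin (sum xs)) (sym (List.map-upTo (S₂ m) (suc m)))
  (Σℕ↔Fin-sum (S₂ m) (suc m) (RGS↔S₂ m) (s≤s ∘ RGS-bound))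

SameKernel : {X A B : Set} → (X → A) → (X → B) → Set
SameKernel f g = ∀ x y → f x ≡ f y ⇔ g x ≡ g y

SameKernel-sym : {X A B : Set} {f : X → A} {g : X → B} → SameKernel f g → SameKernel g f
SameKernel-sym K x y = ⇔.sym (K x y)

SameKernel-trans : {X A B C : Set} {f : X → A} {g : X → B} {h : X → C} →
  SameKernel f g → SameKernel g h → SameKernel f h
SameKernel-trans K L x y = ⇔.trans (K x y) (L x y)

Injective⇒SameKernel : {X A B : Set} {h : A → B} {f : X → A} → Injective _≡_ _≡_ h → SameKernel (h ∘ f) f
Injective⇒SameKernel {h = h} h-injective x y = mk⇔ h-injective (cong h)

SameKernel-∷ : ∀ {m} {A B : Set} {f : Fin (suc m) → A} {g : Fin (suc m) → B} →
  SameKernel (f ∘ suc) (g ∘ suc) → (∀ y → f zero ≡ f (suc y) ⇔ g zero ≡ g (suc y)) → SameKernel f g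
SameKernel-∷ K H zero    zero    = mk⇔ (λ _ → refl) (λ _ → refl)
SameKernel-∷ K H zero    (suc y) = H y
SameKernel-∷ K H (suc x) zero    = mk⇔ (sym ∘ to (H x) ∘ sym) (sym ∘ from (H x) ∘ sym)
SameKernel-∷ K H (suc x) (suc y) = K x y

module _ {A : Set} (_≟ᴬ_ : DecidableEquality A) where

  rgsOf : ∀ {m} → (Fin m → A) → Σ ℕ (RGS m)
  rgsOf {zero}  ρ = 0 , []
  rgsOf {suc m} ρ with rgsOf (ρ ∘ suc) | any? (λ j → ρ (suc j) ≟ᴬ ρ zero)
  ... | k , r | yes (j , _) = k , old (label r j) r
  ... | k , r | no _        = suc k , new r

  rgsOf-kernel : ∀ {m} (ρ : Fin m → A) → SameKernel (label (proj₂ (rgsOf ρ))) ρ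
  rgsOf-kernel {zero}  ρ ()
  rgsOf-kernel {suc m} ρ with rgsOf (ρ ∘ suc) | rgsOf-kernel (ρ ∘ suc) | any? (λ j → ρ (suc j) ≟ᴬ ρ zero)
  ... | k , r | K | yes (j , ρj≡ρ0) =
    SameKernel-∷ K (λ y → subst (λ a → label r j ≡ label r y ⇔ a ≡ ρ (suc y)) ρj≡ρ0 (K j y))
  ... | k , r | K | no ¬∃ =
    SameKernel-∷ (SameKernel-trans (Injective⇒SameKernel suc-injective) K)
      (λ y → mk⇔ (λ ()) (λ ρ0≡ρy → ⊥-elim (¬∃ (y , sym ρ0≡ρy))))

SameKernel⇒≡ : ∀ {m k k′} (r : RGS m k) (s : RGS m k′) → SameKernel (label r) (label s) → (k , r) ≡ (k′ , s)
SameKernel⇒≡ []        []         K = refl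
SameKernel⇒≡ (old ℓ r) (old ℓ′ s) K with SameKernel⇒≡ r s (λ x y → K (suc x) (suc y))
... | refl with label-surjective r ℓ
... | j , refl = cong (λ ℓ′ → _ , old ℓ′ r) (sym (to (K zero (suc j)) refl))
SameKernel⇒≡ (old ℓ r) (new s)    K with label-surjective r ℓ
... | j , refl with to (K zero (suc j)) refl
... | ()
SameKernel⇒≡ (new r)   (old ℓ s)  K with label-surjective s ℓ
... | j , refl with from (K zero (suc j)) refl
... | ()
SameKernel⇒≡ (new r)   (new s)    K
  with SameKernel⇒≡ r s (SameKernel-trans (SameKernel-sym (Injective⇒SameKernel suc-injective))
                          (SameKernel-trans (λ x y → K (suc x) (suc y)) (Injective⇒SameKernel suc-injective)))
... | refl = refl

factor : ∀ {n} → Subset n → Fin n → Z2 n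
factor B i = if does (i ∈? B) then X i else one

factor-zero : ∀ {n} (b : Bool) (B : Subset n) → factor (b ∷ B) zero ≡ b ∷ one
factor-zero false B = refl
factor-zero true  B = cong (true ∷_) (tabulate-false _)
  where
  tabulate-false : ∀ n → tabulate {n = n} (λ _ → false) ≡ one
  tabulate-false zero    = refl
  tabulate-false (suc n) = cong (false ∷_) (tabulate-false n)

factor-suc : ∀ {n} (b : Bool) (B : Subset n) (i : Fin n) → factor (b ∷ B) (suc i) ≡ false ∷ factor B i
factor-suc b B i with does (i ∈? B)
... | true  = refl
... | false = refl

product-suc : ∀ {n} (b : Bool) (B : Subset n) (is : List (Fin n)) →
  foldr (λ i acc → factor (b ∷ B) i · acc) one (map suc is) ≡ false ∷ foldr (λ i acc → factor B i · acc) one is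
product-suc b B []       = refl
product-suc b B (i ∷ is) = cong₂ _·_ (factor-suc b B i) (product-suc b B is)

Y-∷ : ∀ {n} (b : Bool) (B : Subset n) → Y (b ∷ B) ≡ (b ∷ one) · (false ∷ Y B)
Y-∷ {n} b B = cong₂ _·_ (factor-zero b B) (trans
  (cong (foldr (λ i acc → factor (b ∷ B) i · acc) one) (sym (List.map-tabulate {n = n} (λ i → i) (Fin.suc {n}))))
  (product-suc b B (allFin n)))

Y-indicator : ∀ {n} (B : Subset n) → Y B ≡ B
Y-indicator []      = refl
Y-indicator (b ∷ B) = begin
  Y (b ∷ B)                    ≡⟨ Y-∷ b B ⟩
  (b xor false) ∷ (one · Y B)  ≡⟨ cong₂ _∷_ (xor-identityʳ b) (zipWith-identityˡ xor-identityˡ (Y B)) ⟩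
  b ∷ Y B                      ≡⟨ cong (b ∷_) (Y-indicator B) ⟩
  b ∷ B                        ∎
  where open Relation.Binary.PropositionalEquality.≡-Reasoning

⟨⟩-closed : ∀ {n} {gs : List (Z2 n)} (P : Z2 n → Set) → P one → (∀ {g h} → P g → P h → P (g · h)) →
  (∀ {g} → g ∈ˡ gs → P g) → ∀ {g} → ⟨ gs ⟩∋ g → P g
⟨⟩-closed P P-one P-· P-gen (gen g∈gs) = P-gen g∈gs
⟨⟩-closed P P-one P-· P-gen unit       = P-one
⟨⟩-closed P P-one P-· P-gen (mul p q)  = P-· (⟨⟩-closed P P-one P-· P-gen p) (⟨⟩-closed P P-one P-· P-gen q)
⟨⟩-closed P P-one P-· P-gen (invc p)   = ⟨⟩-closed P P-one P-· P-gen p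

⟨⟩-mono : ∀ {n} {gs hs : List (Z2 n)} → gs ⊆ˡ hs → ∀ {g} → ⟨ gs ⟩∋ g → ⟨ hs ⟩∋ g
⟨⟩-mono gs⊆hs = ⟨⟩-closed _ unit mul (gen ∘ gs⊆hs)

-- N ∪ {⋆} is Fin (suc n) with ⋆ = zero; vectors are extended by 0 (false) at ⋆.
coord⋆ : ∀ {n} → Z2 n → Fin (suc n) → Bool
coord⋆ g = lookup (false ∷ g)

coord⋆-one : ∀ {n} (x : Fin (suc n)) → coord⋆ one x ≡ false
coord⋆-one zero    = refl
coord⋆-one (suc x) = lookup-replicate x false

coord⋆-· : ∀ {n} (g h : Z2 n) x → coord⋆ (g · h) x ≡ coord⋆ g x xor coord⋆ h x
coord⋆-· g h x = lookup-zipWith _xor_ x (false ∷ g) (false ∷ h)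

Disjoint : ∀ {n} → List (Subset n) → Set
Disjoint = AllPairs (λ A B → Empty (A ∩ B))

blockOf : ∀ {n} → List (Subset n) → Fin n → Maybe (Subset n)
blockOf []       x = nothing
blockOf (B ∷ bs) x with x ∈? B
... | yes _ = just B
... | no _  = blockOf bs x

blockOf-sound : ∀ {n} (bs : List (Subset n)) {x B} → blockOf bs x ≡ just B → B ∈ˡ bs × x ∈ B
blockOf-sound (B′ ∷ bs) {x} e with x ∈? B′
blockOf-sound (B′ ∷ bs) refl | yes x∈B′ = here refl , x∈B′
... | no _ = let B∈ , x∈B = blockOf-sound bs e in there B∈ , x∈B

blockOf-complete : ∀ {n} {bs : List (Subset n)} {x B} → Disjoint bs → B ∈ˡ bs → x ∈ B → blockOf bs x ≡ just B
blockOf-complete {bs = B′ ∷ bs} {x} (_ ∷ _) (here refl) x∈B with x ∈? B′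
... | yes _    = refl
... | no x∉B′ = ⊥-elim (x∉B′ x∈B)
blockOf-complete {bs = B′ ∷ bs} {x} (B′#bs ∷ bs#) (there B∈) x∈B with x ∈? B′
... | yes x∈B′ = ⊥-elim (All.lookup B′#bs B∈ (x , x∈p∩q⁺ (x∈B′ , x∈B)))
... | no _     = blockOf-complete bs# B∈ x∈B

∈⇔sameBlock : ∀ {n} {bs : List (Subset n)} {B x y} → Disjoint bs → B ∈ˡ bs → x ∈ B →
  y ∈ B ⇔ blockOf bs y ≡ blockOf bs x
∈⇔sameBlock {bs = bs} bs# B∈ x∈B = mk⇔
  (λ y∈B → trans (blockOf-complete bs# B∈ y∈B) (sym (blockOf-complete bs# B∈ x∈B)))
  (λ e → proj₂ (blockOf-sound bs (trans e (blockOf-complete bs# B∈ x∈B))))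

blocks : ∀ {n} → PT n → List (Subset n)
blocks (_ , P) = Partition.blocks P

-- The block (N ∖ T) ∪ {⋆} is represented by `nothing`.
blockOf⋆ : ∀ {n} → PT n → Fin (suc n) → Maybe (Subset n)
blockOf⋆ a zero    = nothing
blockOf⋆ a (suc x) = blockOf (blocks a) x

blockOf⋆-∈ : ∀ {n} (a : PT n) x {B} → blockOf⋆ a x ≡ just B → B ∈ˡ blocks a
blockOf⋆-∈ a (suc x) e = proj₁ (blockOf-sound (blocks a) e)

coord⋆-block⇔ : ∀ {n} (a : PT n) {B} → B ∈ˡ blocks a → ∀ x → coord⋆ B x ≡ true ⇔ blockOf⋆ a x ≡ just B
coord⋆-block⇔ a B∈ zero    = mk⇔ (λ ()) (λ ())
coord⋆-block⇔ (_ , P) {B} B∈ (suc x) = mk⇔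
  (λ Bx → blockOf-complete (Partition.disjoint P) B∈ (lookup⇒[]= x B Bx))
  (λ e → []=⇒lookup (proj₂ (blockOf-sound (Partition.blocks P) e)))

Bool-≡ : ∀ {b c : Bool} → (b ≡ true → c ≡ true) → (c ≡ true → b ≡ true) → b ≡ c
Bool-≡ {false} {false} _ _ = refl
Bool-≡ {false} {true}  _ f = f refl
Bool-≡ {true}  {_}     t _ = sym (t refl)

Maybe-≡ : ∀ {A : Set} {m m′ : Maybe A} →
  (∀ {a} → m ≡ just a → m′ ≡ just a) → (∀ {a} → m′ ≡ just a → m ≡ just a) → m ≡ m′
Maybe-≡ {m = just a}  t _ = sym (t refl)
Maybe-≡ {m = nothing} {nothing} _ _ = refl
Maybe-≡ {m = nothing} {just a}  _ f = f refl

Invariant : ∀ {n} {A : Set} → (Fin (suc n) → A) → Z2 n → Set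
Invariant ρ g = ∀ x y → ρ x ≡ ρ y → coord⋆ g x ≡ coord⋆ g y

H-invariant : ∀ {n} (a : PT n) {g} → H∋ a g → Invariant (blockOf⋆ a) g
H-invariant a = ⟨⟩-closed (Invariant (blockOf⋆ a))
  (λ x y _ → trans (coord⋆-one x) (sym (coord⋆-one y)))
  (λ {g} {h} p q x y e → trans (coord⋆-· g h x) (trans (cong₂ _xor_ (p x y e) (q x y e)) (sym (coord⋆-· g h y))))
  generator
  where
  generator : ∀ {g} → g ∈ˡ map Y (blocks a) → Invariant (blockOf⋆ a) g
  generator g∈ x y e with ∈-map⁻ Y g∈
  ... | B , B∈ , refl rewrite Y-indicator B = Bool-≡
    (λ Bx → from (coord⋆-block⇔ a B∈ y) (trans (sym e) (to (coord⋆-block⇔ a B∈ x) Bx)))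
    (λ By → from (coord⋆-block⇔ a B∈ x) (trans e (to (coord⋆-block⇔ a B∈ y) By)))

H-⊆⇒blockOf⋆ : ∀ {n} (a b : PT n) → (∀ g → H∋ b g → H∋ a g) →
  ∀ x y → blockOf⋆ a x ≡ blockOf⋆ a y → blockOf⋆ b x ≡ blockOf⋆ b y
H-⊆⇒blockOf⋆ a b Hb⊆Ha x y e = Maybe-≡ (transfer x y e) (transfer y x (sym e))
  where
  transfer : ∀ x y {B} → blockOf⋆ a x ≡ blockOf⋆ a y → blockOf⋆ b x ≡ just B → blockOf⋆ b y ≡ just B
  transfer x y {B} e bx = to (coord⋆-block⇔ b B∈ y) (trans (sym Bx≡By) (from (coord⋆-block⇔ b B∈ x) bx))
    where
    B∈ = blockOf⋆-∈ b x bx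
    Bx≡By : coord⋆ B x ≡ coord⋆ B y
    Bx≡By = subst (λ g → coord⋆ g x ≡ coord⋆ g y) (Y-indicator B)
      (H-invariant a (Hb⊆Ha (Y B) (gen (∈-map⁺ Y B∈))) x y e)

SameSubgroup⇒SameKernel : ∀ {n} (a b : PT n) → SameSubgroup a b → SameKernel (blockOf⋆ a) (blockOf⋆ b)
SameSubgroup⇒SameKernel a b same x y = mk⇔
  (H-⊆⇒blockOf⋆ a b (λ g → proj₂ (same g)) x y)
  (H-⊆⇒blockOf⋆ b a (λ g → proj₁ (same g)) x y)

SameKernel⇒blocks-⊆ : ∀ {n} (a b : PT n) → SameKernel (blockOf⋆ a) (blockOf⋆ b) → blocks a ⊆ˡ blocks b
SameKernel⇒blocks-⊆ (_ , P) (_ , Q) K {B} B∈ with All.lookup (Partition.nonempty P) B∈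
... | x , x∈B with blockOf (Partition.blocks Q) x in eq
...   | nothing with trans (from (K zero (suc x)) (sym eq)) (blockOf-complete (Partition.disjoint P) B∈ x∈B)
...     | ()
SameKernel⇒blocks-⊆ (_ , P) (_ , Q) K {B} B∈ | x , x∈B | just B′ =
  subst (_∈ˡ Partition.blocks Q) (sym (⊆-antisym (to ∈B⇔∈B′) (from ∈B⇔∈B′))) B′∈
  where
  B′∈ = proj₁ (blockOf-sound (Partition.blocks Q) eq)
  x∈B′ = proj₂ (blockOf-sound (Partition.blocks Q) eq)
  ∈B⇔∈B′ : ∀ {y} → y ∈ B ⇔ y ∈ B′
  ∈B⇔∈B′ {y} = ⇔.trans (∈⇔sameBlock (Partition.disjoint P) B∈ x∈B)
    (⇔.trans (K (suc y) (suc x)) (⇔.sym (∈⇔sameBlock (Partition.disjoint Q) B′∈ x∈B′)))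

SameKernel⇒SameSubgroup : ∀ {n} (a b : PT n) → SameKernel (blockOf⋆ a) (blockOf⋆ b) → SameSubgroup a b
SameKernel⇒SameSubgroup a b K g =
  ⟨⟩-mono (⊆ˡ.map⁺ Y (SameKernel⇒blocks-⊆ a b K)) ,
  ⟨⟩-mono (⊆ˡ.map⁺ Y (SameKernel⇒blocks-⊆ b a (SameKernel-sym K)))

does≡true⇔ : ∀ {P : Set} (P? : Dec P) → does P? ≡ true ⇔ P
does≡true⇔ (yes p) = mk⇔ (λ _ → p) (λ _ → refl)
does≡true⇔ (no ¬p) = mk⇔ (λ ()) (λ p → ⊥-elim (¬p p))

module _ {n k} (χ : Fin (suc n) → Fin k) where

  fibre : Fin k → Subset n
  fibre ℓ = tabulate (λ x → does (χ (suc x) ≟ ℓ))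

  ∈-fibre⇔ : ∀ {x ℓ} → x ∈ fibre ℓ ⇔ χ (suc x) ≡ ℓ
  ∈-fibre⇔ {x} {ℓ} = mk⇔
    (λ x∈ → to (does≡true⇔ (χ (suc x) ≟ ℓ)) (trans (sym (lookup∘tabulate _ x)) ([]=⇒lookup x∈)))
    (λ e → lookup⇒[]= x (fibre ℓ) (trans (lookup∘tabulate _ x) (from (does≡true⇔ (χ (suc x) ≟ ℓ)) e)))

  fibre-disjoint : ∀ {ℓ ℓ′} → ℓ ≢ ℓ′ → Empty (fibre ℓ ∩ fibre ℓ′)
  fibre-disjoint ℓ≢ℓ′ (x , x∈) = ℓ≢ℓ′ (trans (sym (to ∈-fibre⇔ (p∩q⊆p _ _ x∈))) (to ∈-fibre⇔ (p∩q⊆q _ _ x∈)))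

  BlockLabel : Fin k → Set
  BlockLabel ℓ = χ zero ≢ ℓ × Nonempty (fibre ℓ)

  blockLabel? : ∀ ℓ → Dec (BlockLabel ℓ)
  blockLabel? ℓ = ¬? (χ zero ≟ ℓ) ×-dec nonempty? (fibre ℓ)

  partitionOf : PT n
  partitionOf = ⋃ bs , record
    { blocks   = bs
    ; nonempty = All.map⁺ (All.map proj₂ (All.all-filter blockLabel? (allFin k)))
    ; disjoint = AllPairs.map⁺ (AllPairs.filter⁺ blockLabel? (AllPairs.map fibre-disjoint (allFin⁺ k)))
    ; cover    = refl
    }
    where bs = map fibre (filter blockLabel? (allFin k))

  blockOf⋆-partitionOf-⋆ : ∀ x → χ x ≡ χ zero → blockOf⋆ partitionOf x ≡ nothing
  blockOf⋆-partitionOf-⋆ zero    _ = refl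
  blockOf⋆-partitionOf-⋆ (suc x) χx≡χ0 with blockOf (blocks partitionOf) x in eq
  ... | nothing = refl
  ... | just B with blockOf-sound (blocks partitionOf) eq
  ... | B∈ , x∈B with ∈-map∘filter⁻ fibre blockLabel? {xs = allFin k} B∈
  ... | ℓ , _ , refl , χ0≢ℓ , _ = ⊥-elim (χ0≢ℓ (trans (sym χx≡χ0) (to ∈-fibre⇔ x∈B)))

  blockOf⋆-partitionOf-fibre : ∀ x → χ x ≢ χ zero → blockOf⋆ partitionOf x ≡ just (fibre (χ x))
  blockOf⋆-partitionOf-fibre zero    χx≢χ0 = ⊥-elim (χx≢χ0 refl)
  blockOf⋆-partitionOf-fibre (suc x) χx≢χ0 = blockOf-complete (Partition.disjoint (proj₂ partitionOf))
    (∈-map⁺ fibre (∈-filter⁺ blockLabel? (∈-allFin _) (χx≢χ0 ∘ sym , x , x∈)))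
    x∈
    where x∈ = from ∈-fibre⇔ refl

  fibre-determines : ∀ x {ℓ} → χ x ≢ χ zero → fibre (χ x) ≡ fibre ℓ → χ x ≡ ℓ
  fibre-determines zero    χx≢χ0 _ = ⊥-elim (χx≢χ0 refl)
  fibre-determines (suc x) _     e = to ∈-fibre⇔ (subst (x ∈_) e (from ∈-fibre⇔ refl))

  partitionOf-kernel : SameKernel (blockOf⋆ partitionOf) χ
  partitionOf-kernel x y with χ x ≟ χ zero | χ y ≟ χ zero
  ... | yes x⋆ | yes y⋆ = mk⇔ (λ _ → trans x⋆ (sym y⋆))
    (λ _ → trans (blockOf⋆-partitionOf-⋆ x x⋆) (sym (blockOf⋆-partitionOf-⋆ y y⋆)))
  ... | yes x⋆ | no ¬y⋆ = mk⇔
    (λ e → case trans (sym (blockOf⋆-partitionOf-⋆ x x⋆)) (trans e (blockOf⋆-partitionOf-fibre y ¬y⋆)) of λ ())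
    (λ e → ⊥-elim (¬y⋆ (trans (sym e) x⋆)))
  ... | no ¬x⋆ | yes y⋆ = mk⇔
    (λ e → case trans (sym (blockOf⋆-partitionOf-fibre x ¬x⋆)) (trans e (blockOf⋆-partitionOf-⋆ y y⋆)) of λ ())
    (λ e → ⊥-elim (¬x⋆ (trans e y⋆)))
  ... | no ¬x⋆ | no ¬y⋆ = mk⇔
    (λ e → fibre-determines x ¬x⋆ (just-injective
      (trans (sym (blockOf⋆-partitionOf-fibre x ¬x⋆)) (trans e (blockOf⋆-partitionOf-fibre y ¬y⋆)))))
    (λ e → trans (blockOf⋆-partitionOf-fibre x ¬x⋆)
      (trans (cong (just ∘ fibre) e) (sym (blockOf⋆-partitionOf-fibre y ¬y⋆))))

partitionOfRGS : ∀ {n} → Σ ℕ (RGS (suc n)) → PT n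
partitionOfRGS (_ , r) = partitionOf (label r)

partitionOfRGS-injective : ∀ {n} (c d : Σ ℕ (RGS (suc n))) →
  SameSubgroup (partitionOfRGS c) (partitionOfRGS d) → c ≡ d
partitionOfRGS-injective (_ , r) (_ , s) same = SameKernel⇒≡ r s
  (SameKernel-trans (SameKernel-sym (partitionOf-kernel (label r)))
    (SameKernel-trans (SameSubgroup⇒SameKernel _ _ same) (partitionOf-kernel (label s))))

rgsOfPartition : ∀ {n} → PT n → Σ ℕ (RGS (suc n))
rgsOfPartition a = rgsOf (Maybe.≡-dec (Vec.≡-dec Bool._≟_)) (blockOf⋆ a)

rgsOfPartition-SameSubgroup : ∀ {n} (a : PT n) → SameSubgroup a (partitionOfRGS (rgsOfPartition a))
rgsOfPartition-SameSubgroup a = SameKernel⇒SameSubgroup a _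
  (SameKernel-sym (SameKernel-trans (partitionOf-kernel _) (rgsOf-kernel _ (blockOf⋆ a))))

mainTheorem4 : (n : ℕ) → n ≥ 1 →
    Σ (Fin (Bell (suc n)) → PT n) λ f →
      (∀ i j → SameSubgroup (f i) (f j) → i ≡ j) ×
      (∀ (a : PT n) → ∃ λ i → SameSubgroup a (f i))
mainTheorem4 n _ = partitionOfRGS ∘ decode , injective , surjective
  where
  codes : Fin (Bell (suc n)) ↔ Σ ℕ (RGS (suc n))
  codes = ↔-sym (Σ-RGS↔Bell (suc n))
  open Inverse codes using () renaming (to to decode; from to encode; strictlyInverseˡ to decode-encode)

  injective : ∀ i j → SameSubgroup (partitionOfRGS (decode i)) (partitionOfRGS (decode j)) → i ≡ j
  injective i j same = Injection.injective (↔⇒↣ codes) (partitionOfRGS-injective (decode i) (decode j) same)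

  surjective : ∀ a → ∃ λ i → SameSubgroup a (partitionOfRGS (decode i))
  surjective a = encode (rgsOfPartition a) ,
    subst (SameSubgroup a ∘ partitionOfRGS) (sym (decode-encode (rgsOfPartition a))) (rgsOfPartition-SameSubgroup a)
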